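{- (i) Every normalized monotone set function $f$ on a finite ground set with supermodular degree $\mathrm{SD}(f)=d$ satisfies $\mathrm{SMW}(f)\le d$. (ii) For every integer $m\ge 2$ there exists a normalized monotone set function $f:2^{[m]}\to\mathbb{R}_{\ge 0}$ with $\mathrm{SMW}(f)=1$ and $\mathrm{SD}(f)=m-1$.
   Context: A set function $f:2^X\to\mathbb{R}$ is normalized if $f(\emptyset)=0$ and monotone if $f(S)\le f(T)$ whenever $S\subseteq T$. Write $f(S\mid T)=f(S\cup T)-f(T)$ and $f(v\mid T)=f(\{v\}\mid T)$. A set $T\subseteq X$ is supermodular w.r.t. $f$ if there exist $S\subseteq X$ and $v\in X\setminus T$ with $f(v\mid S\cup T)>\max_{T'\subsetneq T} f(v\mid S\cup T')$; the supermodular width $\mathrm{SMW}(f)$ is the maximum cardinality of a nonempty supermodular set (0 if none). For $u\neq v$ in $X$, $u$ positively depends on $v$ if there is $S\subseteq X$ with $f(u\mid S)>f(u\mid S\setminus\{v\})$; the supermodular degree is $\mathrm{SD}(f)=\max_{u\in X}|\{v: u \text{ positively depends on } v\}|$. $[m]=\{1,\dots,m\}$.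
   Formalization: The set functions in (i) and the witness in (ii) take values in ℚ rather than ℝ. -}

module Defs where

open import Data.Nat using (ℕ; _⊔_)
open import Data.Fin using (Fin)
open import Data.Fin.Properties using (_≟_)
open import Data.Fin.Subset using (Subset; _∪_; ⁅_⁆; _-_; _∉_; _⊆_; _⊂_; ∣_∣; Nonempty; ⊥)
open import Data.Fin.Subset.Properties using (anySubset?)
open import Data.Rational using (ℚ; _<_; _≤_; 0ℚ) renaming (_-_ to _-ℚ_)
import Data.Rational.Properties as ℚP
open import Data.List using (foldr; map; allFin)
open import Data.Vec using (tabulate)
open import Data.Product using (_×_; ∃; Σ-syntax)
open import Relation.Nullary using (¬_; ¬?)
open import Relation.Nullary.Decidable using (⌊_⌋; _×-dec_)
open import Relation.Binary.PropositionalEquality using (_≡_)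

SetFn : ℕ → Set
SetFn n = Subset n → ℚ

Normalized : ∀ {n} → SetFn n → Set
Normalized f = f ⊥ ≡ 0ℚ

Monotone : ∀ {n} → SetFn n → Set
Monotone {n} f = ∀ (S T : Subset n) → S ⊆ T → f S ≤ f T

NonNegative : ∀ {n} → SetFn n → Set
NonNegative {n} f = ∀ (S : Subset n) → 0ℚ ≤ f S

marg : ∀ {n} → SetFn n → Fin n → Subset n → ℚ
marg f v S = f (S ∪ ⁅ v ⁆) -ℚ f S

-- T is supermodular w.r.t. f: ∃ S, v ∉ T with
-- f(v | S ∪ T) > max_{T' ⊊ T} f(v | S ∪ T')
-- (for nonempty T the family T' ⊊ T is nonempty, so "> max" means "> every member")
Supermodular : ∀ {n} → SetFn n → Subset n → Set
Supermodular {n} f T =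
  ∃ λ (S : Subset n) → Σ[ v ∈ Fin n ] (v ∉ T ×
    (∀ (T' : Subset n) → T' ⊂ T → marg f v (S ∪ T') < marg f v (S ∪ T)))

SMW≤ : ∀ {n} → SetFn n → ℕ → Set
SMW≤ {n} f d = ∀ (T : Subset n) → Nonempty T → Supermodular f T → ∣ T ∣ Data.Nat.≤ d

-- SMW(f) = d (d ≥ 1): some nonempty supermodular set of size d, and none larger
SMW≡ : ∀ {n} → SetFn n → ℕ → Set
SMW≡ {n} f d =
  (∃ λ (T : Subset n) → Nonempty T × Supermodular f T × ∣ T ∣ ≡ d) × SMW≤ f d

PosDep : ∀ {n} → SetFn n → Fin n → Fin n → Set
PosDep f u v = ∃ λ S → marg f u (S - v) < marg f u S

depSet : ∀ {n} → SetFn n → Fin n → Subset n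
depSet f u = tabulate λ v →
  ⌊ ¬? (u ≟ v) ×-dec anySubset? (λ S → marg f u (S - v) ℚP.<? marg f u S) ⌋

-- supermodular degree: max over u of |depSet f u| (0 for empty ground set)
SD : ∀ {n} → SetFn n → ℕ
SD {n} f = foldr _⊔_ 0 (map (λ u → ∣ depSet f u ∣) (allFin n))

{-# OPTIONS --safe #-}
-- (i) If S and v witness that T is supermodular, then v positively depends on every t ∈ T:
-- t ∉ S, since otherwise S ∪ (T - t) = S ∪ T contradicts strictness, so (S ∪ T) - t = S ∪ (T - t)
-- and removing t from S ∪ T strictly lowers the marginal of v.  Hence T lies in the dependency
-- set of v.  The centre positively
-- depends on all m - 1 leaves, and every leaf is a supermodular singleton.  The marginals of f
-- are antitone on nonempty sets, so for t ∈ T the marginal at S ∪ {t} dominates the one at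
-- S ∪ T; strictness then forbids {t} ⊂ T, i.e. ∣ T ∣ ≤ 1.
module Submission where

open import Defs

open import Data.Bool using (Bool; true; false; not; _∧_; _∨_; T; b≤b; f≤t) renaming (_≤_ to _≤ᵇ_)
open import Data.Bool.Properties using (≤-minimum; ≤-maximum)
open import Data.Empty using (⊥-elim)
open import Data.Fin using (Fin; zero; suc)
open import Data.Fin.Properties using (_≟_)
open import Data.Fin.Subset
  using (Subset; inside; outside; ⊥; ⊤; ⁅_⁆; _∪_; _─_; _-_; _∈_; _∉_; _⊆_; _⊂_; ∣_∣; Nonempty)
open import Data.Fin.Subset.Properties
  using ( _∈?_; nonempty?; drop-∷-⊆; Empty-unique; ∉⊥; ∈⊤; ⊆⊤; ∣⊤∣≡n; x∈⁅x⁆; x∈⁅y⁆⇒x≡y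
        ; x≢y⇒x∉⁅y⁆; ∣⁅x⁆∣≡1; p⊆q⇒∣p∣≤∣q∣; p⊂q⇒∣p∣<∣q∣; p⊆p∪q; q⊆p∪q; x∈p∪q⁻; ∪-identityˡ
        ; ∪-identityʳ; p─⊥≡p; x∈p⇒p-x⊂p)
open import Data.List using (List; _∷_; foldr; allFin)
open import Data.List.Membership.Propositional using () renaming (_∈_ to _∈ₗ_)
open import Data.List.Membership.Propositional.Properties using (∈-map⁺; ∈-allFin)
open import Data.List.Relation.Unary.All using (All; []; _∷_; universal)
open import Data.List.Relation.Unary.All.Properties using (map⁺)
import Data.List.Relation.Unary.Any as Any
open import Data.Nat using (ℕ; zero; suc; _≤_; _<_; _∸_; _⊔_; z≤n; s≤s; s≤s⁻¹)
open import Data.Nat.Properties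
  using (≤-trans; ≤-reflexive; ≤-antisym; m≤m⊔n; m≤n⊔m; ⊔-lub; module ≤-Reasoning)
open import Data.Product using (_×_; ∃; _,_; proj₁; proj₂; map₂)
open import Data.Rational using (ℚ; 0ℚ; 1ℚ) renaming (_-_ to _-ℚ_; _<_ to _<ℚ_; _≤_ to _≤ℚ_)
import Data.Rational.Properties as ℚP
open import Data.Sum using (inj₁; inj₂)
open import Data.Vec using ([]; _∷_; tabulate; here; there)
open import Data.Vec.Properties using (lookup∘tabulate; lookup⇒[]=; []=⇒lookup)
open import Function using (_∘_; case_of_)
open import Relation.Binary.PropositionalEquality
  using (_≡_; _≢_; refl; sym; trans; cong; subst; subst₂)
open import Relation.Nullary using (Dec; yes; no; does; ¬?)
open import Relation.Nullary.Decidable using (⌊_⌋; toWitness; isYes≗does; dec-true; dec-false)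
open import Relation.Unary using (Pred; Decidable)

p─p≡⊥ : ∀ {n} (p : Subset n) → p ─ p ≡ ⊥
p─p≡⊥ []            = refl
p─p≡⊥ (inside  ∷ p) = cong (outside ∷_) (p─p≡⊥ p)
p─p≡⊥ (outside ∷ p) = cong (outside ∷_) (p─p≡⊥ p)

─-distribʳ-∪ : ∀ {n} (p q r : Subset n) → (p ∪ q) ─ r ≡ (p ─ r) ∪ (q ─ r)
─-distribʳ-∪ []      []      []            = refl
─-distribʳ-∪ (x ∷ p) (y ∷ q) (inside  ∷ r) = cong (outside ∷_) (─-distribʳ-∪ p q r)
─-distribʳ-∪ (x ∷ p) (y ∷ q) (outside ∷ r) = cong ((x ∨ y) ∷_) (─-distribʳ-∪ p q r)

x∉p⇒p-x≡p : ∀ {n} {x : Fin n} {p : Subset n} → x ∉ p → p - x ≡ p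
x∉p⇒p-x≡p {x = zero}  {inside  ∷ p} x∉p = ⊥-elim (x∉p here)
x∉p⇒p-x≡p {x = zero}  {outside ∷ p} _   = cong (outside ∷_) (p─⊥≡p p)
x∉p⇒p-x≡p {x = suc x} {s ∷ p}       x∉p = cong (s ∷_) (x∉p⇒p-x≡p (x∉p ∘ there))

x∈p⇒p∪[q-x]≡p∪q : ∀ {n} {x : Fin n} {p : Subset n} (q : Subset n) → x ∈ p → p ∪ (q - x) ≡ p ∪ q
x∈p⇒p∪[q-x]≡p∪q {p = inside ∷ p} (_ ∷ q) here        = cong (λ r → inside ∷ p ∪ r) (p─⊥≡p q)
x∈p⇒p∪[q-x]≡p∪q {p = s ∷ p}      (t ∷ q) (there x∈p) = cong ((s ∨ t) ∷_) (x∈p⇒p∪[q-x]≡p∪q q x∈p)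

p⊂⁅x⁆⇒p≡⊥ : ∀ {n} {x : Fin n} {p : Subset n} → p ⊂ ⁅ x ⁆ → p ≡ ⊥
p⊂⁅x⁆⇒p≡⊥ {x = x} {p} (p⊆⁅x⁆ , y , y∈⁅x⁆ , y∉p) = Empty-unique λ (z , z∈p) →
  y∉p (subst (_∈ p) (trans (x∈⁅y⁆⇒x≡y x (p⊆⁅x⁆ z∈p)) (sym (x∈⁅y⁆⇒x≡y x y∈⁅x⁆))) z∈p)

x∉p⇒∣p∣<n : ∀ {n} {x : Fin n} {p : Subset n} → x ∉ p → ∣ p ∣ < n
x∉p⇒∣p∣<n {n} {x} {p} x∉p = subst (∣ p ∣ <_) (∣⊤∣≡n n) (p⊂q⇒∣p∣<∣q∣ (⊆⊤ , x , ∈⊤ , x∉p))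

∈-tabulate⁺ : ∀ {n ℓ} {P : Pred (Fin n) ℓ} (P? : Decidable P) {x} → P x → x ∈ tabulate (⌊_⌋ ∘ P?)
∈-tabulate⁺ P? {x} px = lookup⇒[]= x _
  (trans (lookup∘tabulate _ x) (trans (isYes≗does (P? x)) (dec-true (P? x) px)))

∈-tabulate⁻ : ∀ {n ℓ} {P : Pred (Fin n) ℓ} (P? : Decidable P) {x} → x ∈ tabulate (⌊_⌋ ∘ P?) → P x
∈-tabulate⁻ P? {x} x∈ = toWitness (subst T (sym (trans (sym (lookup∘tabulate _ x)) ([]=⇒lookup x∈))) _)

≤-foldr-⊔ : ∀ {x} {xs : List ℕ} → x ∈ₗ xs → x ≤ foldr _⊔_ 0 xs
≤-foldr-⊔ {xs = y ∷ _} (Any.here refl)  = m≤m⊔n y _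
≤-foldr-⊔ {xs = y ∷ _} (Any.there x∈ys) = ≤-trans (≤-foldr-⊔ x∈ys) (m≤n⊔m y _)

foldr-⊔-lub : ∀ {b} {xs : List ℕ} → All (_≤ b) xs → foldr _⊔_ 0 xs ≤ b
foldr-⊔-lub []           = z≤n
foldr-⊔-lub (x≤b ∷ xs≤b) = ⊔-lub x≤b (foldr-⊔-lub xs≤b)

does-mono : ∀ {a b} {A : Set a} {B : Set b} → (A → B) → (a? : Dec A) (b? : Dec B) → does a? ≤ᵇ does b?
does-mono _   (no _)  b?      = ≤-minimum (does b?)
does-mono _   (yes _) (yes _) = b≤b
does-mono A→B (yes a) (no ¬b) = ⊥-elim (¬b (A→B a))

posDep⇒∈depSet : ∀ {n} (f : SetFn n) {u v} → u ≢ v → PosDep f u v → v ∈ depSet f u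
posDep⇒∈depSet f u≢v u→v = ∈-tabulate⁺ _ (u≢v , u→v)

u∉depSet[u] : ∀ {n} (f : SetFn n) u → u ∉ depSet f u
u∉depSet[u] f u u∈ = proj₁ (∈-tabulate⁻ _ u∈) refl

∣depSet∣≤SD : ∀ {n} (f : SetFn n) u → ∣ depSet f u ∣ ≤ SD f
∣depSet∣≤SD f u = ≤-foldr-⊔ (∈-map⁺ (λ u → ∣ depSet f u ∣) (∈-allFin u))

SD-lub : ∀ {n} (f : SetFn n) {b} → (∀ u → ∣ depSet f u ∣ ≤ b) → SD f ≤ b
SD-lub {n} f ∣depSet∣≤b = foldr-⊔-lub (map⁺ (universal ∣depSet∣≤b (allFin n)))

SD≤n∸1 : ∀ {n} (f : SetFn n) → SD f ≤ n ∸ 1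
SD≤n∸1 {zero}  f = z≤n
SD≤n∸1 {suc n} f = SD-lub f λ u → s≤s⁻¹ (x∉p⇒∣p∣<n (u∉depSet[u] f u))

supermodular⇒posDep : ∀ {n} (f : SetFn n) {S T : Subset n} {v} →
  (∀ T' → T' ⊂ T → marg f v (S ∪ T') <ℚ marg f v (S ∪ T)) →
  ∀ {t} → t ∈ T → PosDep f v t
supermodular⇒posDep f {S} {T} {v} strict {t} t∈T = dependence (t ∈? S)
  where
  dropping-t : marg f v (S ∪ (T - t)) <ℚ marg f v (S ∪ T)
  dropping-t = strict (T - t) (x∈p⇒p-x⊂p t∈T)

  dependence : Dec (t ∈ S) → PosDep f v t
  dependence (yes t∈S) = ⊥-elim (ℚP.<-irrefl (cong (marg f v) (x∈p⇒p∪[q-x]≡p∪q T t∈S)) dropping-t)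
  dependence (no  t∉S) = S ∪ T , subst (λ X → marg f v X <ℚ marg f v (S ∪ T)) (sym [S∪T]-t) dropping-t
    where
    [S∪T]-t : (S ∪ T) - t ≡ S ∪ (T - t)
    [S∪T]-t = trans (─-distribʳ-∪ S T ⁅ t ⁆) (cong (_∪ (T - t)) (x∉p⇒p-x≡p t∉S))

supermodular⊆depSet : ∀ {n} (f : SetFn n) {T} → Supermodular f T → ∃ λ v → T ⊆ depSet f v
supermodular⊆depSet f (_ , v , v∉T , strict) =
  v , λ t∈T → posDep⇒∈depSet f (λ { refl → v∉T t∈T }) (supermodular⇒posDep f strict t∈T)

SMW≤SD : ∀ {n} (f : SetFn n) → SMW≤ f (SD f)
SMW≤SD f T _ T-supermodular =
  let v , T⊆depSet = supermodular⊆depSet f T-supermodular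
  in ≤-trans (p⊆q⇒∣p∣≤∣q∣ T⊆depSet) (∣depSet∣≤SD f v)

fromBool : Bool → ℚ
fromBool false = 0ℚ
fromBool true  = 1ℚ

0<1 : 0ℚ <ℚ 1ℚ
0<1 = ℚP.positive⁻¹ 1ℚ

fromBool-mono : ∀ {a b} → a ≤ᵇ b → fromBool a ≤ℚ fromBool b
fromBool-mono b≤b = ℚP.≤-refl
fromBool-mono f≤t = ℚP.<⇒≤ 0<1

module _ {k : ℕ} where

  containsStarEdge : Subset (suc k) → Bool
  containsStarEdge (s ∷ p) = s ∧ does (nonempty? p)

  star : SetFn (suc k)
  star = fromBool ∘ containsStarEdge

  starGain : Fin (suc k) → Subset (suc k) → Bool
  starGain zero    (s ∷ p) = not s ∧ does (nonempty? p)
  starGain (suc _) (s ∷ p) = s ∧ not (does (nonempty? p))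

  marg-star : ∀ v (S : Subset (suc k)) → marg star v S ≡ fromBool (starGain v S)
  marg-star zero    (true  ∷ p) rewrite ∪-identityʳ p = ℚP.+-inverseʳ (fromBool (does (nonempty? p)))
  marg-star zero    (false ∷ p) rewrite ∪-identityʳ p = ℚP.+-identityʳ (fromBool (does (nonempty? p)))
  marg-star (suc w) (false ∷ p) = refl
  marg-star (suc w) (true  ∷ p) rewrite dec-true (nonempty? (p ∪ ⁅ w ⁆)) (w , q⊆p∪q p ⁅ w ⁆ (x∈⁅x⁆ w)) =
    1-fromBool (does (nonempty? p))
    where
    1-fromBool : ∀ b → 1ℚ -ℚ fromBool b ≡ fromBool (not b)
    1-fromBool false = refl
    1-fromBool true  = refl

  containsStarEdge-mono : ∀ {S T : Subset (suc k)} → S ⊆ T → containsStarEdge S ≤ᵇ containsStarEdge T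
  containsStarEdge-mono {S = false ∷ _} _ = ≤-minimum _
  containsStarEdge-mono {S = true ∷ _} {false ∷ _} S⊆T = case S⊆T here of λ ()
  containsStarEdge-mono {S = true ∷ p} {true ∷ q} S⊆T =
    does-mono (map₂ (drop-∷-⊆ S⊆T)) (nonempty? p) (nonempty? q)

  star-nonNegative : NonNegative star
  star-nonNegative S = fromBool-mono (≤-minimum (containsStarEdge S))

  star-monotone : Monotone star
  star-monotone S T S⊆T = fromBool-mono (containsStarEdge-mono S⊆T)

  starGain-antitone : ∀ v {R S : Subset (suc k)} → R ⊆ S → Nonempty R → starGain v S ≤ᵇ starGain v R
  starGain-antitone zero    {S = true ∷ _}            _   _                   = ≤-minimum _
  starGain-antitone zero    {true ∷ _}  {false ∷ _}   R⊆S _                   = case R⊆S here of λ ()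
  starGain-antitone zero    {false ∷ _} {false ∷ _}   _   (zero , ())
  starGain-antitone zero    {false ∷ q} {false ∷ p}   _   (suc x , there x∈q) =
    subst (does (nonempty? p) ≤ᵇ_) (sym (dec-true (nonempty? q) (x , x∈q))) (≤-maximum _)
  starGain-antitone (suc _) {S = false ∷ _}           _   _                   = ≤-minimum _
  starGain-antitone (suc _) {false ∷ _} {true ∷ _}    _   (zero , ())
  starGain-antitone (suc _) {true ∷ q}  {true ∷ p}    R⊆S (zero , here)       =
    does-mono (λ p=∅ q≠∅ → p=∅ (map₂ (drop-∷-⊆ R⊆S) q≠∅)) (¬? (nonempty? p)) (¬? (nonempty? q))
  starGain-antitone (suc _) {_ ∷ q}     {true ∷ p}    R⊆S (suc x , there x∈q)
    rewrite dec-true (nonempty? p) (x , drop-∷-⊆ R⊆S x∈q) = ≤-minimum _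

  marg-star-antitone : ∀ v {R S : Subset (suc k)} → R ⊆ S → Nonempty R → marg star v S ≤ℚ marg star v R
  marg-star-antitone v {R} {S} R⊆S R≠∅ = subst₂ _≤ℚ_ (sym (marg-star v S)) (sym (marg-star v R))
    (fromBool-mono (starGain-antitone v R⊆S R≠∅))

  centre-gains-from-leaf : ∀ (w : Fin k) → marg star zero ⊥ <ℚ marg star zero ⁅ suc w ⁆
  centre-gains-from-leaf w = begin-strict
    marg star zero ⊥                    ≡⟨ marg-star zero ⊥ ⟩
    fromBool (does (nonempty? (⊥ {k}))) ≡⟨ cong fromBool (dec-false (nonempty? (⊥ {k})) (∉⊥ ∘ proj₂)) ⟩
    0ℚ                                  <⟨ 0<1 ⟩
    1ℚ                                  ≡⟨ cong fromBool (dec-true (nonempty? ⁅ w ⁆) (w , x∈⁅x⁆ w)) ⟨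
    fromBool (does (nonempty? ⁅ w ⁆))   ≡⟨ marg-star zero ⁅ suc w ⁆ ⟨
    marg star zero ⁅ suc w ⁆            ∎
    where open ℚP.≤-Reasoning

  leaf-supermodular : ∀ (w : Fin k) → Supermodular star ⁅ suc w ⁆
  leaf-supermodular w = ⊥ , zero , (λ ()) , λ T' T'⊂⁅w⁆ →
    subst₂ (λ X Y → marg star zero X <ℚ marg star zero Y)
      (sym (trans (∪-identityˡ {suc k} T') (p⊂⁅x⁆⇒p≡⊥ {x = suc w} T'⊂⁅w⁆))) (sym (∪-identityˡ ⁅ suc w ⁆))
      (centre-gains-from-leaf w)

  centre-depends-on-leaf : ∀ (w : Fin k) → PosDep star zero (suc w)
  centre-depends-on-leaf w = ⁅ suc w ⁆ ,
    subst (λ X → marg star zero X <ℚ marg star zero ⁅ suc w ⁆) (sym (p─p≡⊥ ⁅ suc w ⁆)) (centre-gains-from-leaf w)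

  star-SMW≤1 : SMW≤ star 1
  star-SMW≤1 T (t , t∈T) (S , v , _ , strict) = ≤-trans (p⊆q⇒∣p∣≤∣q∣ T⊆⁅t⁆) (≤-reflexive (∣⁅x⁆∣≡1 t))
    where
    ⁅t⁆⊆T : ⁅ t ⁆ ⊆ T
    ⁅t⁆⊆T x∈⁅t⁆ = subst (_∈ T) (sym (x∈⁅y⁆⇒x≡y t x∈⁅t⁆)) t∈T

    S∪⁅t⁆⊆S∪T : S ∪ ⁅ t ⁆ ⊆ S ∪ T
    S∪⁅t⁆⊆S∪T x∈ with x∈p∪q⁻ S ⁅ t ⁆ x∈
    ... | inj₁ x∈S    = p⊆p∪q T x∈S
    ... | inj₂ x∈⁅t⁆ = q⊆p∪q S T (⁅t⁆⊆T x∈⁅t⁆)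

    T⊆⁅t⁆ : T ⊆ ⁅ t ⁆
    T⊆⁅t⁆ {u} u∈T with u ≟ t
    ... | yes refl = x∈⁅x⁆ t
    ... | no  u≢t  = ⊥-elim (ℚP.<-irrefl refl (ℚP.<-≤-trans
      (strict ⁅ t ⁆ (⁅t⁆⊆T , u , u∈T , x≢y⇒x∉⁅y⁆ u≢t))
      (marg-star-antitone v S∪⁅t⁆⊆S∪T (t , q⊆p∪q S ⁅ t ⁆ (x∈⁅x⁆ t)))))

  star-SMW≡1 : Fin k → SMW≡ star 1
  star-SMW≡1 w = (⁅ suc w ⁆ , (suc w , x∈⁅x⁆ (suc w)) , leaf-supermodular w , ∣⁅x⁆∣≡1 (suc w)) , star-SMW≤1

  SD-star : SD star ≡ k
  SD-star = ≤-antisym (SD≤n∸1 star) (begin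
    k                    ≡⟨ ∣⊤∣≡n k ⟨
    ∣ outside ∷ ⊤ {k} ∣  ≤⟨ p⊆q⇒∣p∣≤∣q∣ leaves⊆depSet ⟩
    ∣ depSet star zero ∣ ≤⟨ ∣depSet∣≤SD star zero ⟩
    SD star              ∎)
    where
    open ≤-Reasoning
    leaves⊆depSet : outside ∷ ⊤ ⊆ depSet star zero
    leaves⊆depSet {suc w} _ = posDep⇒∈depSet star (λ ()) (centre-depends-on-leaf w)

theorem3 :
    (∀ (n : ℕ) (f : SetFn n) → Normalized f → Monotone f → SMW≤ f (SD f))
    × (∀ (m : ℕ) → 2 ≤ m →
        ∃ λ (f : SetFn m) → NonNegative f × Normalized f × Monotone f
          × SMW≡ f 1 × SD f ≡ m ∸ 1)
theorem3 = (λ _ f _ _ → SMW≤SD f) , starExample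
  where
  starExample : ∀ m → 2 ≤ m → ∃ λ (f : SetFn m) → NonNegative f × Normalized f × Monotone f
                                                  × SMW≡ f 1 × SD f ≡ m ∸ 1
  starExample (suc (suc k)) (s≤s (s≤s z≤n)) =
    star , star-nonNegative , refl , star-monotone , star-SMW≡1 zero , SD-star
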